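{- Let $\pi$ be a permutation of $\{1,\dots,n\}$ avoiding the pattern $312$. Then: (i) $m$ is a consecutive noninversion of $\pi$ if and only if either $m=n$ or $|i_\pi(m)|\neq|i_\pi(m+1)|$; (ii) if $j<k$ then $|i_\pi(j)|\leq|i_\pi(k)|$; (iii) if $k=|i_\pi(m)|$ and $m$ is a consecutive noninversion of $\pi$, then $\pi(k+1)=m$; (iv) the consecutive noninversions of $\pi$ are exactly those entries of $\pi$ that are preceded only by smaller entries; (v) the set of consecutive noninversions of $\pi$ coincides with the set of components of $\max_\pi$; moreover, the position of a consecutive noninversion $m$ in $\pi$ equals the index of the first occurrence of $m$ in $\max_\pi$.
   Context: A permutation $\pi=\pi(1)\pi(2)\cdots\pi(n)$ avoids $312$ if there are no indices $a<b<c$ with $\pi(b)<\pi(c)<\pi(a)$. For an entry $a$ of $\pi$, $i_\pi(a)$ is the set of entries of $\pi$ that are smaller than $a$ and appear before $a$ in $\pi$. An element $m\in\{1,\dots,n\}$ is a consecutive noninversion of $\pi$ if either $m=n$ or $m$ appears before $m+1$ in $\pi$. The vector $\max_\pi$ is defined by $\max_\pi(k)=\max\{\pi(i): i\leq k\}$ for $1\le k\le n$. -}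

module Defs where

open import Data.Nat using (ℕ; suc; _⊔_; _≤_)
open import Data.Fin using (Fin; toℕ; _<_; _≤?_; _<?_)
open import Data.Fin.Permutation using (Permutation′; _⟨$⟩ʳ_; _⟨$⟩ˡ_) public
open import Data.List using (List; foldr; map; filter; length; allFin)
open import Data.Product using (_×_; ∃)
open import Data.Sum using (_⊎_)
open import Relation.Nullary using (¬_)
open import Relation.Nullary.Decidable using (_×-dec_)
open import Relation.Binary.PropositionalEquality using (_≡_)

-- Positions and values are 0-based: position i : Fin n stands for i+1,
-- value v : Fin n stands for the entry v+1.  π(i) is  π ⟨$⟩ʳ i.

pos : ∀ {n} → Permutation′ n → Fin n → Fin n
pos π a = π ⟨$⟩ˡ a

Avoids312 : ∀ {n} → Permutation′ n → Set
Avoids312 {n} π = ∀ (a b c : Fin n) → a < b → b < c →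
  ¬ ((π ⟨$⟩ʳ b) < (π ⟨$⟩ʳ c) × (π ⟨$⟩ʳ c) < (π ⟨$⟩ʳ a))

iSet : ∀ {n} → Permutation′ n → Fin n → List (Fin n)
iSet {n} π a = filter (λ j → (j <? pos π a) ×-dec ((π ⟨$⟩ʳ j) <? a)) (allFin n)

iCard : ∀ {n} → Permutation′ n → Fin n → ℕ
iCard π a = length (iSet π a)

IsLast : ∀ {n} → Fin n → Set
IsLast {n} m = suc (toℕ m) ≡ n

IsSucc : ∀ {n} → Fin n → Fin n → Set
IsSucc m m' = toℕ m' ≡ suc (toℕ m)

ConsecNonInv : ∀ {n} → Permutation′ n → Fin n → Set
ConsecNonInv π m = IsLast m ⊎ ∃ λ m' → IsSucc m m' × pos π m < pos π m'

maxπ : ∀ {n} → Permutation′ n → Fin n → ℕ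
maxπ {n} π k = foldr _⊔_ 0 (map (λ i → toℕ (π ⟨$⟩ʳ i)) (filter (_≤? k) (allFin n)))

module Submission where

open import Defs
open import Data.Nat using (ℕ; _≤_)
open import Data.Fin using (Fin; toℕ; _<_)
open import Data.Product using (_×_; ∃; Σ; _,_; proj₁; proj₂)
open import Data.Sum using (_⊎_; inj₁; inj₂)
open import Function.Bundles using (_⇔_; mk⇔)
open import Relation.Binary.PropositionalEquality using (_≡_; _≢_)

open import Data.Nat as ℕ using (suc; _⊔_; s≤s⁻¹)
import Data.Nat.Properties as ℕ
open import Data.Fin as Fin using (zero; suc; fromℕ<; _<?_; _≤?_)
open import Data.Fin.Properties
  using (toℕ<n; toℕ-injective; toℕ-fromℕ<; <-cmp; <-trans; <-irrefl; <⇒≢; ≤∧≢⇒<)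
open import Data.Fin.Permutation using (inverseˡ; inverseʳ)
open import Data.List using ([]; _∷_; map; filter; length; allFin; foldr; tabulate)
open import Data.List.Properties using (map-tabulate; filter-≐; filter-none)
open import Data.List.Membership.Propositional using (_∈_)
open import Data.List.Membership.Propositional.Properties
  using (∈-filter⁺; ∈-filter⁻; ∈-allFin; ∈-map⁺; ∈-map∘filter⁻)
open import Data.List.Relation.Unary.Any using (here; there)
open import Data.List.Relation.Unary.All.Properties using (tabulate⁺)
open import Data.List.Relation.Binary.Sublist.Propositional.Properties
  using (filter⁺; length-mono-≤; to-≋)
open import Data.List.Relation.Binary.Sublist.Propositional using (⊆-refl)
open import Data.List.Relation.Binary.Pointwise using (Pointwise-≡⇒≡)
open import Data.Empty using (⊥-elim)
open import Function using (_∘_)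
open import Relation.Binary using (tri<; tri≈; tri>)
open import Relation.Binary.PropositionalEquality
  using (refl; sym; trans; cong; subst; subst₂; module ≡-Reasoning)
open import Relation.Nullary using (¬_; yes; no)
open import Relation.Nullary.Decidable using (_×-dec_)
open import Relation.Unary using (Pred; Decidable; _⊆_)
open import Level using (0ℓ)

-- The only use of 312-avoidance: for entries u < v < w, w never stands before
-- u while u stands before v.  Consequently, for j < k every entry counted in
-- i(j) is also counted in i(k), which is (ii); and when m stands before m+1
-- the entry m is counted in i(m+1) but not in i(m), which gives (i).  The rest
-- goes through left-to-right maxima: if m is preceded only by smaller entries,
-- i(m) is the whole prefix before m, so |i(m)| is the position of m, and these
-- entries are exactly the values taken by max_π.

module _ {a p q} {A : Set a} {P : Pred A p} {Q : Pred A q}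
         (P? : Decidable P) (Q? : Decidable Q) where

  length-filter-mono : P ⊆ Q → ∀ xs → length (filter P? xs) ≤ length (filter Q? xs)
  length-filter-mono P⊆Q xs = length-mono-≤ (filter⁺ P? Q? (λ { refl → P⊆Q }) (⊆-refl {x = xs}))

  -- Equal lengths would make the first filtered list a sublist equal to the second.
  length-filter-< : P ⊆ Q → ∀ {x} xs → x ∈ xs → Q x → ¬ P x →
                    length (filter P? xs) ℕ.< length (filter Q? xs)
  length-filter-< P⊆Q xs x∈xs Qx ¬Px = ℕ.≤∧≢⇒< (length-filter-mono P⊆Q xs) λ eq →
    let filters≡ = Pointwise-≡⇒≡ (to-≋ eq (filter⁺ P? Q? (λ { refl → P⊆Q }) (⊆-refl {x = xs})))
    in ¬Px (proj₂ (∈-filter⁻ P? {xs = xs} (subst (_ ∈_) (sym filters≡) (∈-filter⁺ Q? x∈xs Qx))))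

length-filter-map : ∀ {a b p} {A : Set a} {B : Set b} {P : Pred A p}
                    (P? : Decidable P) (f : B → A) xs →
                    length (filter P? (map f xs)) ≡ length (filter (P? ∘ f) xs)
length-filter-map P? f [] = refl
length-filter-map P? f (x ∷ xs) with P? (f x)
... | yes _ = cong suc (length-filter-map P? f xs)
... | no _ = length-filter-map P? f xs

length-filter-<-allFin : ∀ {n} (p : Fin n) → length (filter (_<? p) (allFin n)) ≡ toℕ p
length-filter-<-allFin {suc n} zero =
  cong length (filter-none (_<? Fin.zero {n}) {xs = allFin (suc n)} (tabulate⁺ {f = λ i → i} λ _ ()))
length-filter-<-allFin {suc n} (suc p) = cong suc (begin
  length (filter (_<? suc p) (tabulate (Fin.suc {n})))
    ≡⟨ cong (λ xs → length (filter (_<? suc p) xs)) (sym (map-tabulate {n = n} (λ i → i) Fin.suc)) ⟩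
  length (filter (_<? suc p) (map Fin.suc (allFin n)))
    ≡⟨ length-filter-map (_<? suc p) Fin.suc (allFin n) ⟩
  length (filter (λ j → suc j <? suc p) (allFin n))
    ≡⟨ cong length (filter-≐ (λ j → suc j <? suc p) (_<? p) (ℕ.s<s⁻¹ , ℕ.s<s) (allFin n)) ⟩
  length (filter (_<? p) (allFin n))
    ≡⟨ length-filter-<-allFin p ⟩
  toℕ p ∎)
  where open ≡-Reasoning

foldr-⊔-upperBound : ∀ {x xs} → x ∈ xs → x ≤ foldr _⊔_ 0 xs
foldr-⊔-upperBound {xs = y ∷ ys} (here refl) = ℕ.m≤m⊔n y _
foldr-⊔-upperBound {xs = y ∷ ys} (there x∈ys) =
  ℕ.≤-trans (foldr-⊔-upperBound x∈ys) (ℕ.m≤n⊔m y _)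

foldr-⊔-least : ∀ {b} xs → (∀ {x} → x ∈ xs → x ≤ b) → foldr _⊔_ 0 xs ≤ b
foldr-⊔-least [] bound = ℕ.z≤n
foldr-⊔-least (y ∷ ys) bound = ℕ.⊔-lub (bound (here refl)) (foldr-⊔-least ys (bound ∘ there))

foldr-⊔-∈ : ∀ {x xs} → x ∈ xs → foldr _⊔_ 0 xs ∈ xs
foldr-⊔-∈ {xs = y ∷ []} _ = here (ℕ.⊔-identityʳ y)
foldr-⊔-∈ {xs = y ∷ z ∷ zs} _ with ℕ.⊔-sel y (foldr _⊔_ 0 (z ∷ zs)) | foldr-⊔-∈ {xs = z ∷ zs} (here refl)
... | inj₁ max≡y    | _       = here max≡y
... | inj₂ max≡rest | rest∈zs = there (subst (_∈ z ∷ zs) (sym max≡rest) rest∈zs)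

isSucc⇒< : ∀ {n} {m m' : Fin n} → IsSucc m m' → m < m'
isSucc⇒< {m = m} s = subst (toℕ m ℕ.<_) (sym s) (ℕ.n<1+n (toℕ m))

module _ {n : ℕ} (π : Permutation′ n) where

  private
    π[_] : Fin n → Fin n
    π[ i ] = π ⟨$⟩ʳ i

    value : Fin n → ℕ
    value i = toℕ π[ i ]

  SmallerBefore : Fin n → Pred (Fin n) 0ℓ
  SmallerBefore a j = j < pos π a × π[ j ] < a

  smallerBefore? : ∀ a → Decidable (SmallerBefore a)
  smallerBefore? a j = (j <? pos π a) ×-dec (π[ j ] <? a)

  LeftToRightMax : Fin n → Set
  LeftToRightMax m = ∀ j → j < pos π m → π[ j ] < m

  value-pos : ∀ a → π[ pos π a ] ≡ a
  value-pos a = inverseʳ π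

  pos-value : ∀ j → pos π π[ j ] ≡ j
  pos-value j = inverseˡ π

  value≡⇒pos≡ : ∀ {j a} → π[ j ] ≡ a → j ≡ pos π a
  value≡⇒pos≡ {j} refl = sym (pos-value j)

  before-pos⇒value≢ : ∀ {j a} → j < pos π a → π[ j ] ≢ a
  before-pos⇒value≢ j<pos eq = <-irrefl (value≡⇒pos≡ eq) j<pos

  pos-<⊎> : ∀ {a b} → a ≢ b → pos π a < pos π b ⊎ pos π b < pos π a
  pos-<⊎> {a} {b} a≢b with <-cmp (pos π a) (pos π b)
  ... | tri< lt _ _ = inj₁ lt
  ... | tri≈ _ eq _ = ⊥-elim (a≢b (trans (sym (value-pos a)) (trans (cong π[_] eq) (value-pos b))))
  ... | tri> _ _ gt = inj₂ gt

  leftToRightMax⇒iCard≡pos : ∀ m → LeftToRightMax m → iCard π m ≡ toℕ (pos π m)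
  leftToRightMax⇒iCard≡pos m ltr = begin
    length (filter (smallerBefore? m) (allFin n))
      ≡⟨ cong length (filter-≐ (smallerBefore? m) (_<? pos π m)
                       (proj₁ , λ {j} j<pos → j<pos , ltr j j<pos) (allFin n)) ⟩
    length (filter (_<? pos π m) (allFin n))
      ≡⟨ length-filter-<-allFin (pos π m) ⟩
    toℕ (pos π m) ∎
    where open ≡-Reasoning

  maxπ-upperBound : ∀ {i k} → i Fin.≤ k → toℕ π[ i ] ≤ maxπ π k
  maxπ-upperBound {i} {k} i≤k =
    foldr-⊔-upperBound (∈-map⁺ value (∈-filter⁺ (_≤? k) (∈-allFin i) i≤k))

  maxπ-least : ∀ {k b} → (∀ i → i Fin.≤ k → toℕ π[ i ] ≤ b) → maxπ π k ≤ b
  maxπ-least {k} bound = foldr-⊔-least _ λ mem →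
    let (i , _ , x≡ , i≤k) = ∈-map∘filter⁻ value (_≤? k) {f = value} {xs = allFin n} mem
    in subst (_≤ _) (sym x≡) (bound i i≤k)

  maxπ-attained : ∀ k → ∃ λ i → i Fin.≤ k × maxπ π k ≡ toℕ π[ i ]
  maxπ-attained k =
    let (i , _ , max≡ , i≤k) = ∈-map∘filter⁻ value (_≤? k) {f = value} {xs = allFin n}
          (foldr-⊔-∈ (∈-map⁺ value (∈-filter⁺ (_≤? k) (∈-allFin k) (ℕ.≤-refl {toℕ k}))))
    in i , i≤k , max≡

  leftToRightMax⇒maxπ-at-pos : ∀ m → LeftToRightMax m → maxπ π (pos π m) ≡ toℕ m
  leftToRightMax⇒maxπ-at-pos m ltr = ℕ.≤-antisym
    (maxπ-least bound)
    (subst (_≤ maxπ π (pos π m)) (cong toℕ (value-pos m)) (maxπ-upperBound (ℕ.≤-refl {toℕ (pos π m)})))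
    where
    bound : ∀ i → i Fin.≤ pos π m → toℕ π[ i ] ≤ toℕ m
    bound i i≤pos with ℕ.m≤n⇒m<n∨m≡n i≤pos
    ... | inj₁ i<pos = ℕ.<⇒≤ (ltr i i<pos)
    ... | inj₂ i≡pos = ℕ.≤-reflexive (cong toℕ (trans (cong π[_] (toℕ-injective i≡pos)) (value-pos m)))

  maxπ≡⇒pos≤ : ∀ m k → maxπ π k ≡ toℕ m → pos π m Fin.≤ k
  maxπ≡⇒pos≤ m k max≡m with maxπ-attained k
  ... | i , i≤k , max≡ = subst (Fin._≤ k) (value≡⇒pos≡ (toℕ-injective (trans (sym max≡) max≡m))) i≤k

  maxπ≡⇒leftToRightMax : ∀ m k → maxπ π k ≡ toℕ m → LeftToRightMax m
  maxπ≡⇒leftToRightMax m k max≡m j j<pos = ≤∧≢⇒<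
    (subst (toℕ π[ j ] ≤_) max≡m (maxπ-upperBound (ℕ.≤-trans (ℕ.<⇒≤ j<pos) (maxπ≡⇒pos≤ m k max≡m))))
    (before-pos⇒value≢ j<pos)

  leftToRightMax⇒consecNonInv : ∀ m → LeftToRightMax m → ConsecNonInv π m
  leftToRightMax⇒consecNonInv m ltr with ℕ.m≤n⇒m<n∨m≡n (toℕ<n m)
  ... | inj₂ last = inj₁ last
  ... | inj₁ m<n with pos-<⊎> (<⇒≢ (isSucc⇒< (toℕ-fromℕ< m<n)))
  ...   | inj₁ before = inj₂ (fromℕ< m<n , toℕ-fromℕ< m<n , before)
  ...   | inj₂ after = ⊥-elim (ℕ.<-asym (isSucc⇒< (toℕ-fromℕ< m<n))
                         (subst (_< m) (value-pos (fromℕ< m<n)) (ltr _ after)))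

  module _ (avoids : Avoids312 π) where

    avoids312-values : ∀ {u v w} → u < v → v < w →
                       ¬ (pos π w < pos π u × pos π u < pos π v)
    avoids312-values u<v v<w (wu , uv) = avoids _ _ _ wu uv (at-pos u<v , at-pos v<w)
      where
      at-pos : ∀ {a b} → a < b → π[ pos π a ] < π[ pos π b ]
      at-pos {a} {b} = subst₂ _<_ (sym (value-pos a)) (sym (value-pos b))

    smallerBefore-mono : ∀ {j k} → j < k → SmallerBefore j ⊆ SmallerBefore k
    smallerBefore-mono {j} {k} j<k {x} (x<pos , πx<j) = x<posk , <-trans πx<j j<k
      where
      x<posk : x < pos π k
      x<posk with <-cmp x (pos π k)
      ... | tri< lt _ _ = lt
      ... | tri≈ _ x≡pos _ = ⊥-elim (ℕ.<-asym j<k (subst (_< j) (trans (cong π[_] x≡pos) (value-pos k)) πx<j))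
      ... | tri> _ _ gt = ⊥-elim (avoids312-values πx<j j<k
                            (subst (pos π k <_) (sym (pos-value x)) gt ,
                             subst (_< pos π j) (sym (pos-value x)) x<pos))

    iCard-mono : ∀ j k → j < k → iCard π j ≤ iCard π k
    iCard-mono j k j<k =
      length-filter-mono (smallerBefore? j) (smallerBefore? k) (smallerBefore-mono j<k) (allFin n)

    consecNonInv⇒leftToRightMax : ∀ m → ConsecNonInv π m → LeftToRightMax m
    consecNonInv⇒leftToRightMax m (inj₁ last) j j<pos =
      ≤∧≢⇒< (s≤s⁻¹ (subst (toℕ π[ j ] ℕ.<_) (sym last) (toℕ<n π[ j ])))
            (before-pos⇒value≢ j<pos)
    consecNonInv⇒leftToRightMax m (inj₂ (m' , s , m-before-m')) j j<pos with <-cmp π[ j ] m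
    ... | tri< lt _ _ = lt
    ... | tri≈ _ eq _ = ⊥-elim (before-pos⇒value≢ j<pos eq)
    ... | tri> _ _ gt = ⊥-elim (avoids312-values (isSucc⇒< s) m'<πj
                          (subst (_< pos π m) (sym (pos-value j)) j<pos , m-before-m'))
      where
      m'<πj : m' < π[ j ]
      m'<πj = ≤∧≢⇒< (subst (ℕ._≤ toℕ π[ j ]) (sym s) gt)
                    (λ eq → before-pos⇒value≢ (<-trans j<pos m-before-m') (sym eq))

    -- m before m+1: the entry m itself is counted in i(m+1) but not in i(m).
    precedes-succ⇒iCard< : ∀ {m m'} → IsSucc m m' → pos π m < pos π m' → iCard π m ℕ.< iCard π m'
    precedes-succ⇒iCard< {m} {m'} s m-before-m' =
      length-filter-< (smallerBefore? m) (smallerBefore? m') (smallerBefore-mono (isSucc⇒< s))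
        (allFin n) (∈-allFin (pos π m))
        (m-before-m' , subst (_< m') (sym (value-pos m)) (isSucc⇒< s))
        (<-irrefl refl ∘ proj₁)

    -- Here i(m+1) ⊆ i(m), since an entry standing before m+1 cannot be m itself.
    follows-succ⇒iCard≡ : ∀ {m m'} → IsSucc m m' → pos π m' < pos π m → iCard π m ≡ iCard π m'
    follows-succ⇒iCard≡ {m} {m'} s m'-before-m = cong length
      (filter-≐ (smallerBefore? m) (smallerBefore? m') (smallerBefore-mono (isSucc⇒< s) , shrink) (allFin n))
      where
      shrink : SmallerBefore m' ⊆ SmallerBefore m
      shrink {x} (x<pos , πx<m') = let x<posm = <-trans x<pos m'-before-m in
        x<posm , ≤∧≢⇒< (s≤s⁻¹ (subst (toℕ π[ x ] ℕ.<_) s πx<m')) (before-pos⇒value≢ x<posm)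

    consecNonInv⇔iCard≢ : ∀ m → ConsecNonInv π m ⇔
                          (IsLast m ⊎ ∃ λ m' → IsSucc m m' × iCard π m ≢ iCard π m')
    consecNonInv⇔iCard≢ m = mk⇔ to from
      where
      to : ConsecNonInv π m → IsLast m ⊎ ∃ λ m' → IsSucc m m' × iCard π m ≢ iCard π m'
      to (inj₁ last) = inj₁ last
      to (inj₂ (m' , s , before)) = inj₂ (m' , s , ℕ.<⇒≢ (precedes-succ⇒iCard< s before))
      from : IsLast m ⊎ (∃ λ m' → IsSucc m m' × iCard π m ≢ iCard π m') → ConsecNonInv π m
      from (inj₁ last) = inj₁ last
      from (inj₂ (m' , s , ≢)) with pos-<⊎> (<⇒≢ (isSucc⇒< s))
      ... | inj₁ before = inj₂ (m' , s , before)
      ... | inj₂ after = ⊥-elim (≢ (follows-succ⇒iCard≡ s after))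

mainTheorem11 : ∀ (n : ℕ) (π : Permutation′ n) → Avoids312 π →
    (∀ (m : Fin n) → ConsecNonInv π m ⇔ (IsLast m ⊎ ∃ λ m' → IsSucc m m' × iCard π m ≢ iCard π m'))
    × (∀ (j k : Fin n) → j < k → iCard π j ≤ iCard π k)
    × (∀ (m : Fin n) → ConsecNonInv π m → Σ (Fin n) λ p → toℕ p ≡ iCard π m × π ⟨$⟩ʳ p ≡ m)
    × (∀ (m : Fin n) → ConsecNonInv π m ⇔ (∀ (j : Fin n) → j < pos π m → π ⟨$⟩ʳ j < m))
    × (∀ (m : Fin n) → ConsecNonInv π m ⇔ (∃ λ (k : Fin n) → maxπ π k ≡ toℕ m))
    × (∀ (m : Fin n) → ConsecNonInv π m →
    maxπ π (pos π m) ≡ toℕ m × (∀ (k : Fin n) → maxπ π k ≡ toℕ m → pos π m Data.Fin.≤ k))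
mainTheorem11 n π avoids =
    consecNonInv⇔iCard≢ π avoids
  , iCard-mono π avoids
  , (λ m c → pos π m , sym (leftToRightMax⇒iCard≡pos π m (ltr m c)) , value-pos π m)
  , (λ m → mk⇔ (ltr m) (leftToRightMax⇒consecNonInv π m))
  , (λ m → mk⇔ (λ c → pos π m , leftToRightMax⇒maxπ-at-pos π m (ltr m c))
               (λ (k , max≡m) → leftToRightMax⇒consecNonInv π m (maxπ≡⇒leftToRightMax π m k max≡m)))
  , (λ m c → leftToRightMax⇒maxπ-at-pos π m (ltr m c) , λ k → maxπ≡⇒pos≤ π m k)
  where
  ltr : ∀ m → ConsecNonInv π m → LeftToRightMax π m
  ltr = consecNonInv⇒leftToRightMax π avoids
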